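{- In the setting below, coefficientwise \[ \frac{(1-gt)^2(1-(n_1-1)t^2)}{(1-2gt-(n-1)t^2)(1-2gt^2-(n-1)t^4)}\leq2\cdot\frac{1-gt}{1-2gt-(n-1)t^2}. \]
   Context: $X/\mathbb{Q}$ is a smooth proper geometrically connected curve of genus $g$, $D\subset X$ a reduced effective divisor of degree $n$ with $2g+n>2$, and $n_1:=\#D(\mathbb{R})$. Inequality of power series is coefficientwise. -}

module Defs where

open import Data.Nat using (ℕ; zero; suc; _∸_)
open import Data.Integer using (ℤ; +_; -_; _+_; _*_; _-_)
open import Data.List using (List; []; _∷_; foldr; map; upTo; zipWith)

PowerSeries : Set
PowerSeries = ℕ → ℤ

sumℤ : List ℤ → ℤ
sumℤ = foldr _+_ (+ 0)

poly : List ℤ → PowerSeries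
poly []       k       = + 0
poly (a ∷ as) zero    = a
poly (a ∷ as) (suc k) = poly as k

_⊗_ : PowerSeries → PowerSeries → PowerSeries
(f ⊗ h) k = sumℤ (map (λ i → f i * h (k ∸ i)) (upTo (suc k)))

-- Coefficients c_k, …, c_0 (most recent first) of the inverse of a power
-- series f with constant term 1:  c₀ = 1,  c_{k+1} = - Σ_{j=0}^{k} f(j+1) c_{k-j}.
invCoeffs : PowerSeries → ℕ → List ℤ
invCoeffs f zero    = + 1 ∷ []
invCoeffs f (suc k) =
  let cs = invCoeffs f k in
  - sumℤ (zipWith _*_ (map (λ j → f (suc j)) (upTo (suc k))) cs) ∷ cs

-- Multiplicative inverse of a power series whose constant term is 1.
inv₁ : PowerSeries → PowerSeries
inv₁ f k with invCoeffs f k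
... | []    = + 0
... | c ∷ _ = c

_≤ₚ_ : PowerSeries → PowerSeries → Set
f ≤ₚ h = ∀ k → f k Data.Integer.≤ h k

lhs : ℕ → ℕ → ℕ → PowerSeries
lhs g n n₁ =
  (poly (+ 1 ∷ - (+ g) ∷ []) ⊗ poly (+ 1 ∷ - (+ g) ∷ []))
  ⊗ (poly (+ 1 ∷ + 0 ∷ - ((+ n₁) - + 1) ∷ [])
  ⊗ (inv₁ (poly (+ 1 ∷ - (+ (2 Data.Nat.* g)) ∷ - ((+ n) - + 1) ∷ []))
  ⊗ inv₁ (poly (+ 1 ∷ + 0 ∷ - (+ (2 Data.Nat.* g)) ∷ + 0 ∷ - ((+ n) - + 1) ∷ []))))

rhs : ℕ → ℕ → PowerSeries
rhs g n =
  poly (+ 2 ∷ []) ⊗ (poly (+ 1 ∷ - (+ g) ∷ [])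
  ⊗ inv₁ (poly (+ 1 ∷ - (+ (2 Data.Nat.* g)) ∷ - ((+ n) - + 1) ∷ [])))

{-# OPTIONS --safe #-}
-- Write P = 1 - g t, A = 1 - 2g t - (n - 1) t², B = 1 - 2g t² - (n - 1) t⁴ and
-- C = 1 - (n₁ - 1) t².  Then RHS - LHS = N / (A B) with the quintic N = 2 P B - P² C, which we
-- factor as Z · B⁻¹ with Z = N / A.  Past the degree of N, both Z and B⁻¹ satisfy the linear
-- recurrence with coefficients 2g and n - 1 (in steps of 2 for B⁻¹).  For n ≥ 1 this makes them
-- nonnegative once their first few coefficients are; for n = 0 it still does when 2g ≥ 2 and
-- those coefficients increase.  The first six coefficients of Z are explicit polynomials in g,
-- u = (n + n₁)/2 and n, nonnegative for g = 0 (where n ≥ 3) and for g ≥ 2.  For g = 1 the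
-- coefficient of t² can be -1; there Z - (1 - t²) ≥ 0, and (1 - t²) B⁻¹ ≥ 0 because B⁻¹
-- increases in steps of 2.
module Submission where

open import Defs
open import Data.Nat as ℕ using (ℕ; zero; suc; _∸_; z≤n; s≤s)
import Data.Nat.Properties as ℕ
open import Data.Integer using (ℤ; +_; -_; _+_; _*_; _-_; _≤_; 0ℤ; +≤+)
import Data.Integer.Properties as ℤ
open import Data.Integer.Tactic.RingSolver using (solve; solve-∀)
open import Data.List using (List; []; _∷_; map; zipWith; applyUpTo; upTo; downFrom)
open import Data.Product using (_×_; _,_; proj₁; proj₂; ∃)
open import Function using (_∘_; id)
open import Relation.Binary.PropositionalEquality
open ≡-Reasoning

shift : PowerSeries → PowerSeries
shift f k = f (suc k)

map-applyUpTo : ∀ {A B : Set} (f : A → B) g n → map f (applyUpTo g n) ≡ applyUpTo (f ∘ g) n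
map-applyUpTo f g zero    = refl
map-applyUpTo f g (suc n) = cong (f (g 0) ∷_) (map-applyUpTo f (g ∘ suc) n)

⊗-suc : ∀ f h k → (f ⊗ h) (suc k) ≡ f 0 * h (suc k) + (shift f ⊗ h) k
⊗-suc f h k = cong (λ x → f 0 * h (suc k) + x) (cong sumℤ (begin
  map (λ i → f i * h (suc k ∸ i)) (applyUpTo suc (suc k))  ≡⟨ map-applyUpTo _ suc (suc k) ⟩
  applyUpTo (λ i → f (suc i) * h (k ∸ i)) (suc k)          ≡⟨ map-applyUpTo _ id (suc k) ⟨
  map (λ i → f (suc i) * h (k ∸ i)) (applyUpTo id (suc k)) ∎))

⊗-cong : ∀ {f f′ h h′} → f ≗ f′ → h ≗ h′ → f ⊗ h ≗ f′ ⊗ h′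
⊗-cong {f} {f′} {h} {h′} f≗f′ h≗h′ zero = cong₂ (λ a b → a * b + 0ℤ) (f≗f′ 0) (h≗h′ 0)
⊗-cong {f} {f′} {h} {h′} f≗f′ h≗h′ (suc k) = begin
  (f ⊗ h) (suc k)                      ≡⟨ ⊗-suc f h k ⟩
  f 0 * h (suc k) + (shift f ⊗ h) k    ≡⟨ cong₂ _+_ (cong₂ _*_ (f≗f′ 0) (h≗h′ (suc k)))
                                                    (⊗-cong (f≗f′ ∘ suc) h≗h′ k) ⟩
  f′ 0 * h′ (suc k) + (shift f′ ⊗ h′) k ≡⟨ ⊗-suc f′ h′ k ⟨
  (f′ ⊗ h′) (suc k)                    ∎

⊗-congˡ : ∀ f {h h′} → h ≗ h′ → f ⊗ h ≗ f ⊗ h′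
⊗-congˡ f = ⊗-cong {f} {f} (λ _ → refl)

⊗-congʳ : ∀ h {f f′} → f ≗ f′ → f ⊗ h ≗ f′ ⊗ h
⊗-congʳ h f≗f′ = ⊗-cong {h = h} {h′ = h} f≗f′ (λ _ → refl)

⊗-zeroˡ : ∀ h → poly [] ⊗ h ≗ poly []
⊗-zeroˡ h zero    = refl
⊗-zeroˡ h (suc k) = trans (⊗-suc (poly []) h k) (trans (ℤ.+-identityˡ _) (⊗-zeroˡ h k))

⊗-distribʳ : ∀ a b f h q k →
  ((λ i → a * f i + b * h i) ⊗ q) k ≡ a * (f ⊗ q) k + b * (h ⊗ q) k
⊗-distribʳ a b f h q zero = expand a b (f 0) (h 0) (q 0)
  where expand : ∀ a b x y z → (a * x + b * y) * z + 0ℤ ≡ a * (x * z + 0ℤ) + b * (y * z + 0ℤ)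
        expand = solve-∀
⊗-distribʳ a b f h q (suc k) = begin
  ((λ i → a * f i + b * h i) ⊗ q) (suc k)
    ≡⟨ ⊗-suc (λ i → a * f i + b * h i) q k ⟩
  (a * f 0 + b * h 0) * q (suc k) + ((λ i → a * f (suc i) + b * h (suc i)) ⊗ q) k
    ≡⟨ cong (λ x → (a * f 0 + b * h 0) * q (suc k) + x) (⊗-distribʳ a b (shift f) (shift h) q k) ⟩
  (a * f 0 + b * h 0) * q (suc k) + (a * (shift f ⊗ q) k + b * (shift h ⊗ q) k)
    ≡⟨ rearrange a b (f 0) (h 0) (q (suc k)) ((shift f ⊗ q) k) ((shift h ⊗ q) k) ⟩
  a * (f 0 * q (suc k) + (shift f ⊗ q) k) + b * (h 0 * q (suc k) + (shift h ⊗ q) k)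
    ≡⟨ cong₂ (λ x y → a * x + b * y) (⊗-suc f q k) (⊗-suc h q k) ⟨
  a * (f ⊗ q) (suc k) + b * (h ⊗ q) (suc k) ∎
  where rearrange : ∀ a b x y z u v → (a * x + b * y) * z + (a * u + b * v) ≡ a * (x * z + u) + b * (y * z + v)
        rearrange = solve-∀

⊗-sucʳ : ∀ f h k → (f ⊗ h) (suc k) ≡ (f ⊗ shift h) k + f (suc k) * h 0
⊗-sucʳ f h zero = reorder (f 0) (h 1) (f 1) (h 0)
  where reorder : ∀ a b c d → a * b + (c * d + 0ℤ) ≡ (a * b + 0ℤ) + c * d
        reorder = solve-∀
⊗-sucʳ f h (suc k) = begin
  (f ⊗ h) (suc (suc k))
    ≡⟨ ⊗-suc f h (suc k) ⟩
  f 0 * h (suc (suc k)) + (shift f ⊗ h) (suc k)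
    ≡⟨ cong (λ x → f 0 * h (suc (suc k)) + x) (⊗-sucʳ (shift f) h k) ⟩
  f 0 * h (suc (suc k)) + ((shift f ⊗ shift h) k + f (suc (suc k)) * h 0)
    ≡⟨ ℤ.+-assoc (f 0 * h (suc (suc k))) _ _ ⟨
  f 0 * h (suc (suc k)) + (shift f ⊗ shift h) k + f (suc (suc k)) * h 0
    ≡⟨ cong (λ x → x + f (suc (suc k)) * h 0) (⊗-suc f (shift h) k) ⟨
  (f ⊗ shift h) (suc k) + f (suc (suc k)) * h 0 ∎

⊗-comm : ∀ f h → f ⊗ h ≗ h ⊗ f
⊗-comm f h zero    = cong (λ x → x + 0ℤ) (ℤ.*-comm (f 0) (h 0))
⊗-comm f h (suc k) = begin
  (f ⊗ h) (suc k)                    ≡⟨ ⊗-suc f h k ⟩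
  f 0 * h (suc k) + (shift f ⊗ h) k  ≡⟨ cong₂ _+_ (ℤ.*-comm (f 0) (h (suc k))) (⊗-comm (shift f) h k) ⟩
  h (suc k) * f 0 + (h ⊗ shift f) k  ≡⟨ ℤ.+-comm (h (suc k) * f 0) _ ⟩
  (h ⊗ shift f) k + h (suc k) * f 0  ≡⟨ ⊗-sucʳ h f k ⟨
  (h ⊗ f) (suc k)                    ∎

⊗-assoc : ∀ f g h → (f ⊗ g) ⊗ h ≗ f ⊗ (g ⊗ h)
⊗-assoc f g h zero = reassociate (f 0) (g 0) (h 0)
  where reassociate : ∀ a b c → (a * b + 0ℤ) * c + 0ℤ ≡ a * (b * c + 0ℤ) + 0ℤ
        reassociate = solve-∀
⊗-assoc f g h (suc k) = begin
  ((f ⊗ g) ⊗ h) (suc k)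
    ≡⟨ ⊗-suc (f ⊗ g) h k ⟩
  (f ⊗ g) 0 * h (suc k) + (shift (f ⊗ g) ⊗ h) k
    ≡⟨ cong (λ x → (f ⊗ g) 0 * h (suc k) + x) (⊗-congʳ h (⊗-suc′ f g) k) ⟩
  (f ⊗ g) 0 * h (suc k) + ((λ i → f 0 * shift g i + + 1 * (shift f ⊗ g) i) ⊗ h) k
    ≡⟨ cong (λ x → (f ⊗ g) 0 * h (suc k) + x) (⊗-distribʳ (f 0) (+ 1) (shift g) (shift f ⊗ g) h k) ⟩
  (f ⊗ g) 0 * h (suc k) + (f 0 * (shift g ⊗ h) k + + 1 * ((shift f ⊗ g) ⊗ h) k)
    ≡⟨ cong (λ x → (f ⊗ g) 0 * h (suc k) + (f 0 * (shift g ⊗ h) k + + 1 * x)) (⊗-assoc (shift f) g h k) ⟩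
  (f 0 * g 0 + 0ℤ) * h (suc k) + (f 0 * (shift g ⊗ h) k + + 1 * (shift f ⊗ (g ⊗ h)) k)
    ≡⟨ regroup (f 0) (g 0) (h (suc k)) ((shift g ⊗ h) k) ((shift f ⊗ (g ⊗ h)) k) ⟩
  f 0 * (g 0 * h (suc k) + (shift g ⊗ h) k) + (shift f ⊗ (g ⊗ h)) k
    ≡⟨ cong (λ x → f 0 * x + (shift f ⊗ (g ⊗ h)) k) (⊗-suc g h k) ⟨
  f 0 * (g ⊗ h) (suc k) + (shift f ⊗ (g ⊗ h)) k
    ≡⟨ ⊗-suc f (g ⊗ h) k ⟨
  (f ⊗ (g ⊗ h)) (suc k) ∎
  where
  ⊗-suc′ : ∀ f g → shift (f ⊗ g) ≗ λ i → f 0 * shift g i + + 1 * (shift f ⊗ g) i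
  ⊗-suc′ f g i = trans (⊗-suc f g i) (cong (λ x → f 0 * shift g i + x) (sym (ℤ.*-identityˡ _)))
  regroup : ∀ a b c u v → (a * b + 0ℤ) * c + (a * u + + 1 * v) ≡ a * (b * c + u) + v
  regroup = solve-∀

poly-singleton-⊗ : ∀ a h k → (poly (a ∷ []) ⊗ h) k ≡ a * h k
poly-singleton-⊗ a h zero    = ℤ.+-identityʳ (a * h 0)
poly-singleton-⊗ a h (suc k) = begin
  (poly (a ∷ []) ⊗ h) (suc k)      ≡⟨ ⊗-suc (poly (a ∷ [])) h k ⟩
  a * h (suc k) + (poly [] ⊗ h) k  ≡⟨ cong (λ x → a * h (suc k) + x) (⊗-zeroˡ h k) ⟩
  a * h (suc k) + 0ℤ               ≡⟨ ℤ.+-identityʳ (a * h (suc k)) ⟩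
  a * h (suc k)                    ∎

1ₚ : PowerSeries
1ₚ = poly (+ 1 ∷ [])

⊗-identityˡ : ∀ h → 1ₚ ⊗ h ≗ h
⊗-identityˡ h k = trans (poly-singleton-⊗ (+ 1) h k) (ℤ.*-identityˡ (h k))

sum-zipWith≡⊗ : ∀ f h k → sumℤ (zipWith _*_ (map f (upTo (suc k))) (map h (downFrom (suc k)))) ≡ (f ⊗ h) k
sum-zipWith≡⊗ f h zero    = refl
sum-zipWith≡⊗ f h (suc k) = begin
  f 0 * h (suc k) + sumℤ (zipWith _*_ (map f (applyUpTo suc (suc k))) (map h (downFrom (suc k))))
    ≡⟨ cong (λ fs → f 0 * h (suc k) + sumℤ (zipWith _*_ fs (map h (downFrom (suc k)))))
            (trans (map-applyUpTo f suc (suc k)) (sym (map-applyUpTo (shift f) id (suc k)))) ⟩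
  f 0 * h (suc k) + sumℤ (zipWith _*_ (map (shift f) (upTo (suc k))) (map h (downFrom (suc k))))
    ≡⟨ cong (λ x → f 0 * h (suc k) + x) (sum-zipWith≡⊗ (shift f) h k) ⟩
  f 0 * h (suc k) + (shift f ⊗ h) k
    ≡⟨ ⊗-suc f h k ⟨
  (f ⊗ h) (suc k) ∎

invCoeffs-≡ : ∀ f k → invCoeffs f k ≡ map (inv₁ f) (downFrom (suc k))
invCoeffs-≡ f zero    = refl
invCoeffs-≡ f (suc k) = cong (inv₁ f (suc k) ∷_) (invCoeffs-≡ f k)

inv₁-suc : ∀ f k → inv₁ f (suc k) ≡ - (shift f ⊗ inv₁ f) k
inv₁-suc f k = cong -_ (begin
  sumℤ (zipWith _*_ (map (shift f) (upTo (suc k))) (invCoeffs f k))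
    ≡⟨ cong (λ cs → sumℤ (zipWith _*_ (map (shift f) (upTo (suc k))) cs)) (invCoeffs-≡ f k) ⟩
  sumℤ (zipWith _*_ (map (shift f) (upTo (suc k))) (map (inv₁ f) (downFrom (suc k))))
    ≡⟨ sum-zipWith≡⊗ (shift f) (inv₁ f) k ⟩
  (shift f ⊗ inv₁ f) k ∎)

⊗-inv₁ : ∀ f → f 0 ≡ + 1 → f ⊗ inv₁ f ≗ 1ₚ
⊗-inv₁ f f₀≡1 zero    = cong (λ a → a * + 1 + 0ℤ) f₀≡1
⊗-inv₁ f f₀≡1 (suc k) = begin
  (f ⊗ inv₁ f) (suc k)                          ≡⟨ ⊗-suc f (inv₁ f) k ⟩
  f 0 * inv₁ f (suc k) + (shift f ⊗ inv₁ f) k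
    ≡⟨ cong₂ (λ a b → a * b + (shift f ⊗ inv₁ f) k) f₀≡1 (inv₁-suc f k) ⟩
  + 1 * - (shift f ⊗ inv₁ f) k + (shift f ⊗ inv₁ f) k ≡⟨ cancel ((shift f ⊗ inv₁ f) k) ⟩
  0ℤ                                            ∎
  where cancel : ∀ x → + 1 * - x + x ≡ 0ℤ
        cancel = solve-∀

⊗-inv₁-cancel : ∀ f h → f 0 ≡ + 1 → f ⊗ (h ⊗ inv₁ f) ≗ h
⊗-inv₁-cancel f h f₀≡1 k = begin
  (f ⊗ (h ⊗ inv₁ f)) k  ≡⟨ ⊗-assoc f h (inv₁ f) k ⟨
  ((f ⊗ h) ⊗ inv₁ f) k  ≡⟨ ⊗-congʳ (inv₁ f) (⊗-comm f h) k ⟩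
  ((h ⊗ f) ⊗ inv₁ f) k  ≡⟨ ⊗-assoc h f (inv₁ f) k ⟩
  (h ⊗ (f ⊗ inv₁ f)) k  ≡⟨ ⊗-congˡ h (⊗-inv₁ f f₀≡1) k ⟩
  (h ⊗ 1ₚ) k            ≡⟨ ⊗-comm h 1ₚ k ⟩
  (1ₚ ⊗ h) k            ≡⟨ ⊗-identityˡ h k ⟩
  h k                   ∎

infixl 6 _+ₗ_
infixl 7 _*ₗ_
infixr 8 _·ₗ_

_+ₗ_ : List ℤ → List ℤ → List ℤ
[]       +ₗ ys       = ys
(x ∷ xs) +ₗ []       = x ∷ xs
(x ∷ xs) +ₗ (y ∷ ys) = x + y ∷ xs +ₗ ys

_·ₗ_ : ℤ → List ℤ → List ℤ
a ·ₗ []       = []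
a ·ₗ (x ∷ xs) = a * x ∷ a ·ₗ xs

_*ₗ_ : List ℤ → List ℤ → List ℤ
[]       *ₗ ys = []
(x ∷ xs) *ₗ ys = x ·ₗ ys +ₗ (0ℤ ∷ xs *ₗ ys)

poly-+ₗ : ∀ xs ys k → poly (xs +ₗ ys) k ≡ poly xs k + poly ys k
poly-+ₗ []       ys       k       = sym (ℤ.+-identityˡ (poly ys k))
poly-+ₗ (x ∷ xs) []       k       = sym (ℤ.+-identityʳ (poly (x ∷ xs) k))
poly-+ₗ (x ∷ xs) (y ∷ ys) zero    = refl
poly-+ₗ (x ∷ xs) (y ∷ ys) (suc k) = poly-+ₗ xs ys k

poly-·ₗ : ∀ a xs k → poly (a ·ₗ xs) k ≡ a * poly xs k
poly-·ₗ a []       k       = sym (ℤ.*-zeroʳ a)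
poly-·ₗ a (x ∷ xs) zero    = refl
poly-·ₗ a (x ∷ xs) (suc k) = poly-·ₗ a xs k

poly-*ₗ : ∀ xs ys → poly (xs *ₗ ys) ≗ poly xs ⊗ poly ys
poly-*ₗ []       ys k = sym (⊗-zeroˡ (poly ys) k)
poly-*ₗ (x ∷ xs) ys k = begin
  poly (x ·ₗ ys +ₗ (0ℤ ∷ xs *ₗ ys)) k          ≡⟨ poly-+ₗ (x ·ₗ ys) (0ℤ ∷ xs *ₗ ys) k ⟩
  poly (x ·ₗ ys) k + poly (0ℤ ∷ xs *ₗ ys) k    ≡⟨ cong (λ a → a + poly (0ℤ ∷ xs *ₗ ys) k) (poly-·ₗ x ys k) ⟩
  x * poly ys k + poly (0ℤ ∷ xs *ₗ ys) k       ≡⟨ shifted k ⟩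
  (poly (x ∷ xs) ⊗ poly ys) k                  ∎
  where
  shifted : ∀ k → x * poly ys k + poly (0ℤ ∷ xs *ₗ ys) k ≡ (poly (x ∷ xs) ⊗ poly ys) k
  shifted zero    = refl
  shifted (suc k) = trans (cong (λ a → x * poly ys (suc k) + a) (poly-*ₗ xs ys k))
                          (sym (⊗-suc (poly (x ∷ xs)) (poly ys) k))

quotient-recurrence : ∀ {p q} y F → poly (+ 1 ∷ - p ∷ - q ∷ []) ⊗ y ≗ F →
  y 0 ≡ F 0 × y 1 ≡ F 1 + p * y 0 × (∀ k → y (2 ℕ.+ k) ≡ F (2 ℕ.+ k) + (p * y (1 ℕ.+ k) + q * y k))
quotient-recurrence {p} {q} y F eq =
  isolate₀ (y 0) (F 0) (eq 0) , isolate₁ (y 1) (y 0) (F 1) (eq 1) , λ k →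
  isolate₂ (y (2 ℕ.+ k)) (y (1 ℕ.+ k)) (y k) (F (2 ℕ.+ k)) (begin
    + 1 * y (2 ℕ.+ k) + (- p * y (1 ℕ.+ k) + - q * y k)
      ≡⟨ cong (λ x → + 1 * y (2 ℕ.+ k) + (- p * y (1 ℕ.+ k) + x)) (poly-singleton-⊗ (- q) y k) ⟨
    + 1 * y (2 ℕ.+ k) + (- p * y (1 ℕ.+ k) + (poly (- q ∷ []) ⊗ y) k)
      ≡⟨ cong (λ x → + 1 * y (2 ℕ.+ k) + x) (⊗-suc (poly (- p ∷ - q ∷ [])) y k) ⟨
    + 1 * y (2 ℕ.+ k) + (poly (- p ∷ - q ∷ []) ⊗ y) (1 ℕ.+ k)
      ≡⟨ ⊗-suc (poly (+ 1 ∷ - p ∷ - q ∷ [])) y (1 ℕ.+ k) ⟨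
    (poly (+ 1 ∷ - p ∷ - q ∷ []) ⊗ y) (2 ℕ.+ k)
      ≡⟨ eq (2 ℕ.+ k) ⟩
    F (2 ℕ.+ k) ∎)
  where
  isolate₀ : ∀ a c → + 1 * a + 0ℤ ≡ c → a ≡ c
  isolate₀ a _ refl = solve (a ∷ [])
  isolate₁ : ∀ a b c → + 1 * a + (- p * b + 0ℤ) ≡ c → a ≡ c + p * b
  isolate₁ a b _ refl = solve (a ∷ b ∷ p ∷ [])
  isolate₂ : ∀ a b d c → + 1 * a + (- p * b + - q * d) ≡ c → a ≡ c + (p * b + q * d)
  isolate₂ a b d _ refl = solve (a ∷ b ∷ d ∷ p ∷ q ∷ [])

even-quotient-recurrence : ∀ {p q} y F → poly (+ 1 ∷ 0ℤ ∷ - p ∷ 0ℤ ∷ - q ∷ []) ⊗ y ≗ F →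
  y 0 ≡ F 0 × y 1 ≡ F 1 × y 2 ≡ F 2 + p * y 0 × y 3 ≡ F 3 + p * y 1 ×
  (∀ k → y (4 ℕ.+ k) ≡ F (4 ℕ.+ k) + (p * y (2 ℕ.+ k) + q * y k))
even-quotient-recurrence {p} {q} y F eq =
  isolate₀ (y 0) (F 0) (eq 0) , isolate₁ (y 1) (y 0) (F 1) (eq 1) ,
  isolate₂ (y 2) (y 1) (y 0) (F 2) (eq 2) , isolate₃ (y 3) (y 2) (y 1) (y 0) (F 3) (eq 3) , λ k →
  isolate₄ (y (4 ℕ.+ k)) (y (3 ℕ.+ k)) (y (2 ℕ.+ k)) (y (1 ℕ.+ k)) (y k) (F (4 ℕ.+ k))
           (trans (sym (expand k)) (eq (4 ℕ.+ k)))
  where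
  isolate₀ : ∀ a c → + 1 * a + 0ℤ ≡ c → a ≡ c
  isolate₀ a _ refl = solve (a ∷ [])
  isolate₁ : ∀ a b c → + 1 * a + (0ℤ * b + 0ℤ) ≡ c → a ≡ c
  isolate₁ a b _ refl = solve (a ∷ b ∷ [])
  isolate₂ : ∀ a b d c → + 1 * a + (0ℤ * b + (- p * d + 0ℤ)) ≡ c → a ≡ c + p * d
  isolate₂ a b d _ refl = solve (a ∷ b ∷ d ∷ p ∷ [])
  isolate₃ : ∀ a b d e c → + 1 * a + (0ℤ * b + (- p * d + (0ℤ * e + 0ℤ))) ≡ c → a ≡ c + p * d
  isolate₃ a b d e _ refl = solve (a ∷ b ∷ d ∷ e ∷ p ∷ [])
  isolate₄ : ∀ a b d e f c → + 1 * a + (0ℤ * b + (- p * d + (0ℤ * e + - q * f))) ≡ c → a ≡ c + (p * d + q * f)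
  isolate₄ a b d e f _ refl = solve (a ∷ b ∷ d ∷ e ∷ f ∷ p ∷ q ∷ [])
  expand : ∀ k → (poly (+ 1 ∷ 0ℤ ∷ - p ∷ 0ℤ ∷ - q ∷ []) ⊗ y) (4 ℕ.+ k) ≡
                 + 1 * y (4 ℕ.+ k) + (0ℤ * y (3 ℕ.+ k) + (- p * y (2 ℕ.+ k) + (0ℤ * y (1 ℕ.+ k) + - q * y k)))
  expand k = begin
    (poly (+ 1 ∷ 0ℤ ∷ - p ∷ 0ℤ ∷ - q ∷ []) ⊗ y) (4 ℕ.+ k)
      ≡⟨ ⊗-suc (poly (+ 1 ∷ 0ℤ ∷ - p ∷ 0ℤ ∷ - q ∷ [])) y (3 ℕ.+ k) ⟩
    + 1 * y (4 ℕ.+ k) + (poly (0ℤ ∷ - p ∷ 0ℤ ∷ - q ∷ []) ⊗ y) (3 ℕ.+ k)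
      ≡⟨ cong (λ x → + 1 * y (4 ℕ.+ k) + x) (⊗-suc (poly (0ℤ ∷ - p ∷ 0ℤ ∷ - q ∷ [])) y (2 ℕ.+ k)) ⟩
    + 1 * y (4 ℕ.+ k) + (0ℤ * y (3 ℕ.+ k) + (poly (- p ∷ 0ℤ ∷ - q ∷ []) ⊗ y) (2 ℕ.+ k))
      ≡⟨ cong (λ x → + 1 * y (4 ℕ.+ k) + (0ℤ * y (3 ℕ.+ k) + x))
              (⊗-suc (poly (- p ∷ 0ℤ ∷ - q ∷ [])) y (1 ℕ.+ k)) ⟩
    + 1 * y (4 ℕ.+ k) + (0ℤ * y (3 ℕ.+ k) + (- p * y (2 ℕ.+ k) + (poly (0ℤ ∷ - q ∷ []) ⊗ y) (1 ℕ.+ k)))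
      ≡⟨ cong (λ x → + 1 * y (4 ℕ.+ k) + (0ℤ * y (3 ℕ.+ k) + (- p * y (2 ℕ.+ k) + x)))
              (⊗-suc (poly (0ℤ ∷ - q ∷ [])) y k) ⟩
    + 1 * y (4 ℕ.+ k) + (0ℤ * y (3 ℕ.+ k) + (- p * y (2 ℕ.+ k) + (0ℤ * y (1 ℕ.+ k) + (poly (- q ∷ []) ⊗ y) k)))
      ≡⟨ cong (λ x → + 1 * y (4 ℕ.+ k) + (0ℤ * y (3 ℕ.+ k) + (- p * y (2 ℕ.+ k) + (0ℤ * y (1 ℕ.+ k) + x))))
              (poly-singleton-⊗ (- q) y k) ⟩
    + 1 * y (4 ℕ.+ k) + (0ℤ * y (3 ℕ.+ k) + (- p * y (2 ℕ.+ k) + (0ℤ * y (1 ℕ.+ k) + - q * y k))) ∎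

infixl 6 _⊕_
infixl 7 _⊛_

_⊕_ : ∀ {i j} → 0ℤ ≤ i → 0ℤ ≤ j → 0ℤ ≤ i + j
_⊕_ = ℤ.+-mono-≤

_⊛_ : ∀ {i j} → 0ℤ ≤ i → 0ℤ ≤ j → 0ℤ ≤ i * j
_⊛_ {+ m} {+ n} _ _ = subst (0ℤ ≤_) (ℤ.pos-* m n) (+≤+ z≤n)

#_ : ∀ n → 0ℤ ≤ + n
# n = +≤+ z≤n

0≤-by : ∀ {i j} → 0ℤ ≤ j → i ≡ j → 0ℤ ≤ i
0≤-by 0≤j refl = 0≤j

0ₚ : PowerSeries
0ₚ = poly []

⊗-nonneg : ∀ {f h} → 0ₚ ≤ₚ f → 0ₚ ≤ₚ h → 0ₚ ≤ₚ (f ⊗ h)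
⊗-nonneg f≥0 h≥0 zero    = f≥0 0 ⊛ h≥0 0 ⊕ # 0
⊗-nonneg {f} {h} f≥0 h≥0 (suc k) =
  0≤-by (f≥0 0 ⊛ h≥0 (suc k) ⊕ ⊗-nonneg (f≥0 ∘ suc) h≥0 k) (⊗-suc f h k)

nonneg-from-4 : ∀ {y} → 0ℤ ≤ y 0 → 0ℤ ≤ y 1 → 0ℤ ≤ y 2 → 0ℤ ≤ y 3 →
  (∀ k → 0ℤ ≤ y (4 ℕ.+ k)) → 0ₚ ≤ₚ y
nonneg-from-4 y₀≥0 y₁≥0 y₂≥0 y₃≥0 tail≥0 0 = y₀≥0
nonneg-from-4 y₀≥0 y₁≥0 y₂≥0 y₃≥0 tail≥0 1 = y₁≥0
nonneg-from-4 y₀≥0 y₁≥0 y₂≥0 y₃≥0 tail≥0 2 = y₂≥0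
nonneg-from-4 y₀≥0 y₁≥0 y₂≥0 y₃≥0 tail≥0 3 = y₃≥0
nonneg-from-4 y₀≥0 y₁≥0 y₂≥0 y₃≥0 tail≥0 (suc (suc (suc (suc k)))) = tail≥0 k

nonneg-recurrence : ∀ {p q} (y : PowerSeries) → 0ℤ ≤ p → 0ℤ ≤ q →
  (∀ k → y (2 ℕ.+ k) ≡ p * y (1 ℕ.+ k) + q * y k) →
  0ℤ ≤ y 0 → 0ℤ ≤ y 1 → ∀ k → 0ℤ ≤ y k
nonneg-recurrence y p≥0 q≥0 rec y₀≥0 y₁≥0 k = proj₁ (consecutive k)
  where
  consecutive : ∀ k → 0ℤ ≤ y k × 0ℤ ≤ y (1 ℕ.+ k)
  consecutive zero    = y₀≥0 , y₁≥0
  consecutive (suc k) with consecutive k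
  ... | yₖ≥0 , yₖ₊₁≥0 = yₖ₊₁≥0 , 0≤-by (p≥0 ⊛ yₖ₊₁≥0 ⊕ q≥0 ⊛ yₖ≥0) (rec k)

monotone-recurrence : ∀ {p q} (y : PowerSeries) → 0ℤ ≤ p - + 2 → 0ℤ ≤ q + + 1 →
  (∀ k → y (2 ℕ.+ k) ≡ p * y (1 ℕ.+ k) + q * y k) →
  0ℤ ≤ y 0 → 0ℤ ≤ y 1 - y 0 → ∀ k → 0ℤ ≤ y k × 0ℤ ≤ y (1 ℕ.+ k) - y k
monotone-recurrence {p} {q} y p≥2 q≥-1 rec y₀≥0 y₀≤y₁ zero    = y₀≥0 , y₀≤y₁
monotone-recurrence {p} {q} y p≥2 q≥-1 rec y₀≥0 y₀≤y₁ (suc k)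
  with monotone-recurrence {p} {q} y p≥2 q≥-1 rec y₀≥0 y₀≤y₁ k
... | yₖ≥0 , yₖ≤yₖ₊₁ =
  0≤-by (yₖ≤yₖ₊₁ ⊕ yₖ≥0) (step₁ (y k) (y (1 ℕ.+ k))) ,
  0≤-by (p≥2 ⊛ (yₖ≤yₖ₊₁ ⊕ yₖ≥0) ⊕ q≥-1 ⊛ yₖ≥0 ⊕ yₖ≤yₖ₊₁)
        (step₂ (y k) (y (1 ℕ.+ k)) (y (2 ℕ.+ k)) (rec k))
  where
  step₁ : ∀ a b → b ≡ b - a + a
  step₁ a b = solve (a ∷ b ∷ [])
  step₂ : ∀ a b c → c ≡ p * b + q * a → c - b ≡ (p - + 2) * (b - a + a) + (q + + 1) * a + (b - a)
  step₂ a b _ refl = solve (a ∷ b ∷ p ∷ q ∷ [])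

interleave : ∀ {P : ℕ → Set} → (∀ j → P (j ℕ.* 2)) → (∀ j → P (suc (j ℕ.* 2))) → ∀ k → P k
interleave even odd zero          = even 0
interleave even odd (suc zero)    = odd 0
interleave {P} even odd (suc (suc k)) = interleave {P ∘ suc ∘ suc} (even ∘ suc) (odd ∘ suc) k

even-nonneg-recurrence : ∀ {p q} (y : PowerSeries) → 0ℤ ≤ p → 0ℤ ≤ q →
  (∀ k → y (4 ℕ.+ k) ≡ p * y (2 ℕ.+ k) + q * y k) →
  0ℤ ≤ y 0 → 0ℤ ≤ y 1 → 0ℤ ≤ y 2 → 0ℤ ≤ y 3 → 0ₚ ≤ₚ y
even-nonneg-recurrence y p≥0 q≥0 rec y₀≥0 y₁≥0 y₂≥0 y₃≥0 = interleave
  (nonneg-recurrence (λ j → y (j ℕ.* 2)) p≥0 q≥0 (λ j → rec (j ℕ.* 2)) y₀≥0 y₂≥0)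
  (nonneg-recurrence (λ j → y (suc (j ℕ.* 2))) p≥0 q≥0 (λ j → rec (suc (j ℕ.* 2))) y₁≥0 y₃≥0)

even-monotone-recurrence : ∀ {p q} (y : PowerSeries) → 0ℤ ≤ p - + 2 → 0ℤ ≤ q + + 1 →
  (∀ k → y (4 ℕ.+ k) ≡ p * y (2 ℕ.+ k) + q * y k) →
  0ℤ ≤ y 0 → 0ℤ ≤ y 1 → 0ℤ ≤ y 2 - y 0 → 0ℤ ≤ y 3 - y 1 →
  0ₚ ≤ₚ y × (∀ k → 0ℤ ≤ y (2 ℕ.+ k) - y k)
even-monotone-recurrence {p} {q} y p≥2 q≥-1 rec y₀≥0 y₁≥0 y₀≤y₂ y₁≤y₃ =
  interleave (proj₁ ∘ even) (proj₁ ∘ odd) , interleave (proj₂ ∘ even) (proj₂ ∘ odd)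
  where
  even = monotone-recurrence {p} {q} (λ j → y (j ℕ.* 2)) p≥2 q≥-1 (λ j → rec (j ℕ.* 2)) y₀≥0 y₀≤y₂
  odd  = monotone-recurrence {p} {q} (λ j → y (suc (j ℕ.* 2))) p≥2 q≥-1 (λ j → rec (suc (j ℕ.* 2))) y₁≥0 y₁≤y₃

lag₂-difference-nonneg : ∀ {y} → 0ₚ ≤ₚ y → (∀ k → 0ℤ ≤ y (2 ℕ.+ k) - y k) →
  0ₚ ≤ₚ (poly (+ 1 ∷ 0ℤ ∷ - + 1 ∷ []) ⊗ y)
lag₂-difference-nonneg y≥0 y-mono zero          = # 1 ⊛ y≥0 0 ⊕ # 0
lag₂-difference-nonneg y≥0 y-mono (suc zero)    = # 1 ⊛ y≥0 1 ⊕ (# 0 ⊛ y≥0 0 ⊕ # 0)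
lag₂-difference-nonneg {y} y≥0 y-mono (suc (suc k)) = 0≤-by (y-mono k) (begin
  (poly (+ 1 ∷ 0ℤ ∷ - + 1 ∷ []) ⊗ y) (2 ℕ.+ k)
    ≡⟨ ⊗-suc (poly (+ 1 ∷ 0ℤ ∷ - + 1 ∷ [])) y (1 ℕ.+ k) ⟩
  + 1 * y (2 ℕ.+ k) + (poly (0ℤ ∷ - + 1 ∷ []) ⊗ y) (1 ℕ.+ k)
    ≡⟨ cong (λ x → + 1 * y (2 ℕ.+ k) + x) (⊗-suc (poly (0ℤ ∷ - + 1 ∷ [])) y k) ⟩
  + 1 * y (2 ℕ.+ k) + (0ℤ * y (1 ℕ.+ k) + (poly (- + 1 ∷ []) ⊗ y) k)
    ≡⟨ cong (λ x → + 1 * y (2 ℕ.+ k) + (0ℤ * y (1 ℕ.+ k) + x)) (poly-singleton-⊗ (- + 1) y k) ⟩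
  + 1 * y (2 ℕ.+ k) + (0ℤ * y (1 ℕ.+ k) + - + 1 * y k)
    ≡⟨ difference (y (2 ℕ.+ k)) (y (1 ℕ.+ k)) (y k) ⟩
  y (2 ℕ.+ k) - y k ∎)
  where
  difference : ∀ a b c → + 1 * a + (0ℤ * b + - + 1 * c) ≡ a - c
  difference = solve-∀

-- G₂, S and R stand for 2g, n - 1 and n₁ - 1; with these, the series lhs and rhs of Defs are
-- (P ⊗ P) ⊗ (C ⊗ (A⁻¹ ⊗ B⁻¹)) and [2] ⊗ (P ⊗ A⁻¹) definitionally.
module Gap (G G₂ S R : ℤ) where

  P A B C : List ℤ
  P = + 1 ∷ - G ∷ []
  A = + 1 ∷ - G₂ ∷ - S ∷ []
  B = + 1 ∷ 0ℤ ∷ - G₂ ∷ 0ℤ ∷ - S ∷ []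
  C = + 1 ∷ 0ℤ ∷ - R ∷ []

  A⁻¹ B⁻¹ : PowerSeries
  A⁻¹ = inv₁ (poly A)
  B⁻¹ = inv₁ (poly B)

  numerator : List ℤ
  numerator = + 1 ∷ 0ℤ ∷ R - G * G - + 2 * G₂ ∷ + 2 * G * G₂ - + 2 * G * R ∷ G * G * R - + 2 * S ∷ + 2 * G * S ∷ []

  numerator-≡ : numerator ≡ (+ 2) ·ₗ (P *ₗ B) +ₗ (- + 1) ·ₗ (P *ₗ P *ₗ C)
  numerator-≡ =
    cong₂ _∷_ (solve vars) (cong₂ _∷_ (solve vars) (cong₂ _∷_ (solve vars)
      (cong₂ _∷_ (solve vars) (cong₂ _∷_ (solve vars) (cong₂ _∷_ (solve vars) refl)))))
    where vars = G ∷ G₂ ∷ S ∷ R ∷ []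

  Z Δ : PowerSeries
  Z = poly numerator ⊗ A⁻¹
  Δ = Z ⊗ B⁻¹

  rhs-lhs≡Δ : ∀ k →
    (poly (+ 2 ∷ []) ⊗ (poly P ⊗ A⁻¹)) k - ((poly P ⊗ poly P) ⊗ (poly C ⊗ (A⁻¹ ⊗ B⁻¹))) k ≡ Δ k
  rhs-lhs≡Δ k = begin
    (poly (+ 2 ∷ []) ⊗ (poly P ⊗ A⁻¹)) k - ((poly P ⊗ poly P) ⊗ (poly C ⊗ X)) k
      ≡⟨ cong₂ _-_ (trans (poly-singleton-⊗ (+ 2) (poly P ⊗ A⁻¹) k) (cong (+ 2 *_) (rhs-numerator k)))
                   (lhs-numerator k) ⟩
    + 2 * (poly (P *ₗ B) ⊗ X) k - (poly (P *ₗ P *ₗ C) ⊗ X) k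
      ≡⟨ combine ((poly (P *ₗ B) ⊗ X) k) ((poly (P *ₗ P *ₗ C) ⊗ X) k) ⟩
    + 2 * (poly (P *ₗ B) ⊗ X) k + - + 1 * (poly (P *ₗ P *ₗ C) ⊗ X) k
      ≡⟨ ⊗-distribʳ (+ 2) (- + 1) (poly (P *ₗ B)) (poly (P *ₗ P *ₗ C)) X k ⟨
    ((λ i → + 2 * poly (P *ₗ B) i + - + 1 * poly (P *ₗ P *ₗ C) i) ⊗ X) k
      ≡⟨ ⊗-congʳ X numerator-expansion k ⟨
    (poly numerator ⊗ X) k
      ≡⟨ ⊗-assoc (poly numerator) A⁻¹ B⁻¹ k ⟨
    Δ k ∎
    where
    X = A⁻¹ ⊗ B⁻¹
    combine : ∀ a b → + 2 * a - b ≡ + 2 * a + - + 1 * b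
    combine = solve-∀
    rhs-numerator : poly P ⊗ A⁻¹ ≗ poly (P *ₗ B) ⊗ X
    rhs-numerator i = begin
      (poly P ⊗ A⁻¹) i                ≡⟨ ⊗-congˡ (poly P) (λ j → sym (⊗-inv₁-cancel (poly B) A⁻¹ refl j)) i ⟩
      (poly P ⊗ (poly B ⊗ X)) i     ≡⟨ ⊗-assoc (poly P) (poly B) X i ⟨
      ((poly P ⊗ poly B) ⊗ X) i     ≡⟨ ⊗-congʳ X (λ j → sym (poly-*ₗ P B j)) i ⟩
      (poly (P *ₗ B) ⊗ X) i         ∎
    lhs-numerator : (poly P ⊗ poly P) ⊗ (poly C ⊗ X) ≗ poly (P *ₗ P *ₗ C) ⊗ X
    lhs-numerator i = begin
      ((poly P ⊗ poly P) ⊗ (poly C ⊗ X)) i  ≡⟨ ⊗-assoc (poly P ⊗ poly P) (poly C) X i ⟨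
      (((poly P ⊗ poly P) ⊗ poly C) ⊗ X) i  ≡⟨ ⊗-congʳ X product i ⟩
      (poly (P *ₗ P *ₗ C) ⊗ X) i            ∎
      where
      product : (poly P ⊗ poly P) ⊗ poly C ≗ poly (P *ₗ P *ₗ C)
      product j = trans (⊗-congʳ (poly C) (λ l → sym (poly-*ₗ P P l)) j) (sym (poly-*ₗ (P *ₗ P) C j))
    numerator-expansion : poly numerator ≗ λ i → + 2 * poly (P *ₗ B) i + - + 1 * poly (P *ₗ P *ₗ C) i
    numerator-expansion i = begin
      poly numerator i
        ≡⟨ cong (λ L → poly L i) numerator-≡ ⟩
      poly ((+ 2) ·ₗ (P *ₗ B) +ₗ (- + 1) ·ₗ (P *ₗ P *ₗ C)) i
        ≡⟨ poly-+ₗ ((+ 2) ·ₗ (P *ₗ B)) ((- + 1) ·ₗ (P *ₗ P *ₗ C)) i ⟩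
      poly ((+ 2) ·ₗ (P *ₗ B)) i + poly ((- + 1) ·ₗ (P *ₗ P *ₗ C)) i
        ≡⟨ cong₂ _+_ (poly-·ₗ (+ 2) (P *ₗ B) i) (poly-·ₗ (- + 1) (P *ₗ P *ₗ C) i) ⟩
      + 2 * poly (P *ₗ B) i + - + 1 * poly (P *ₗ P *ₗ C) i ∎

  Z-recurrence : Z 0 ≡ + 1 × Z 1 ≡ 0ℤ + G₂ * Z 0 ×
    (∀ k → Z (2 ℕ.+ k) ≡ poly numerator (2 ℕ.+ k) + (G₂ * Z (1 ℕ.+ k) + S * Z k))
  Z-recurrence = quotient-recurrence Z (poly numerator) (⊗-inv₁-cancel (poly A) (poly numerator) refl)

  Z₀ : Z 0 ≡ + 1
  Z₀ = proj₁ Z-recurrence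

  Z₁ : Z 1 ≡ 0ℤ + G₂ * Z 0
  Z₁ = proj₁ (proj₂ Z-recurrence)

  Z-step : ∀ k → Z (2 ℕ.+ k) ≡ poly numerator (2 ℕ.+ k) + (G₂ * Z (1 ℕ.+ k) + S * Z k)
  Z-step = proj₂ (proj₂ Z-recurrence)

  Z-tail : ∀ k → Z (4 ℕ.+ (2 ℕ.+ k)) ≡ G₂ * Z (4 ℕ.+ (1 ℕ.+ k)) + S * Z (4 ℕ.+ k)
  Z-tail k = trans (Z-step (4 ℕ.+ k)) (ℤ.+-identityˡ (G₂ * Z (5 ℕ.+ k) + S * Z (4 ℕ.+ k)))

  B⁻¹-recurrence : B⁻¹ 0 ≡ + 1 × B⁻¹ 1 ≡ 0ℤ × B⁻¹ 2 ≡ 0ℤ + G₂ * B⁻¹ 0 × B⁻¹ 3 ≡ 0ℤ + G₂ * B⁻¹ 1 ×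
    (∀ k → B⁻¹ (4 ℕ.+ k) ≡ 0ℤ + (G₂ * B⁻¹ (2 ℕ.+ k) + S * B⁻¹ k))
  B⁻¹-recurrence = even-quotient-recurrence B⁻¹ 1ₚ (⊗-inv₁ (poly B) refl)

  B⁻¹₀ : B⁻¹ 0 ≡ + 1
  B⁻¹₀ = proj₁ B⁻¹-recurrence

  B⁻¹₁ : B⁻¹ 1 ≡ 0ℤ
  B⁻¹₁ = proj₁ (proj₂ B⁻¹-recurrence)

  B⁻¹₂ : B⁻¹ 2 ≡ G₂
  B⁻¹₂ = begin
    B⁻¹ 2            ≡⟨ proj₁ (proj₂ (proj₂ B⁻¹-recurrence)) ⟩
    0ℤ + G₂ * B⁻¹ 0  ≡⟨ ℤ.+-identityˡ (G₂ * B⁻¹ 0) ⟩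
    G₂ * B⁻¹ 0       ≡⟨ cong (G₂ *_) B⁻¹₀ ⟩
    G₂ * + 1         ≡⟨ ℤ.*-identityʳ G₂ ⟩
    G₂               ∎

  B⁻¹₃ : B⁻¹ 3 ≡ 0ℤ
  B⁻¹₃ = begin
    B⁻¹ 3            ≡⟨ proj₁ (proj₂ (proj₂ (proj₂ B⁻¹-recurrence))) ⟩
    0ℤ + G₂ * B⁻¹ 1  ≡⟨ ℤ.+-identityˡ (G₂ * B⁻¹ 1) ⟩
    G₂ * B⁻¹ 1       ≡⟨ cong (G₂ *_) B⁻¹₁ ⟩
    G₂ * 0ℤ          ≡⟨ ℤ.*-zeroʳ G₂ ⟩
    0ℤ               ∎

  B⁻¹-tail : ∀ k → B⁻¹ (4 ℕ.+ k) ≡ G₂ * B⁻¹ (2 ℕ.+ k) + S * B⁻¹ k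
  B⁻¹-tail k = trans (proj₂ (proj₂ (proj₂ (proj₂ B⁻¹-recurrence))) k)
                     (ℤ.+-identityˡ (G₂ * B⁻¹ (2 ℕ.+ k) + S * B⁻¹ k))

  B⁻¹-nonneg : 0ℤ ≤ G₂ → 0ℤ ≤ S → 0ₚ ≤ₚ B⁻¹
  B⁻¹-nonneg G₂≥0 S≥0 = even-nonneg-recurrence B⁻¹ G₂≥0 S≥0 B⁻¹-tail
    (0≤-by (# 1) B⁻¹₀) (0≤-by (# 0) B⁻¹₁) (0≤-by G₂≥0 B⁻¹₂) (0≤-by (# 0) B⁻¹₃)

  B⁻¹-monotone : 0ℤ ≤ G₂ - + 2 → 0ℤ ≤ S + + 1 → 0ₚ ≤ₚ B⁻¹ × (∀ k → 0ℤ ≤ B⁻¹ (2 ℕ.+ k) - B⁻¹ k)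
  B⁻¹-monotone G₂≥2 S≥-1 = even-monotone-recurrence {G₂} {S} B⁻¹ G₂≥2 S≥-1 B⁻¹-tail
    (0≤-by (# 1) B⁻¹₀) (0≤-by (# 0) B⁻¹₁)
    (0≤-by (G₂≥2 ⊕ # 1) (trans (cong₂ _-_ B⁻¹₂ B⁻¹₀) (solve (G₂ ∷ []))))
    (0≤-by (# 0) (cong₂ _-_ B⁻¹₃ B⁻¹₁))

-- Gap with its parameters expressed through g, u = (n + n₁)/2 and n, so that n₁ - 1 = 2u - n - 1.
module GapUN (G U N : ℤ) where

  open Gap G (+ 2 * G) (N - + 1) (+ 2 * U - N - + 1) public

  private
    vars = G ∷ U ∷ N ∷ []
    substitute : ∀ {a b c A B : ℤ} n → c ≡ n + (+ 2 * G * b + (N - + 1) * a) → a ≡ A → b ≡ B →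
      c ≡ n + (+ 2 * G * B + (N - + 1) * A)
    substitute n c≡ refl refl = c≡

  Z₁≡ : Z 1 ≡ + 2 * G
  Z₁≡ = trans Z₁ (trans (cong (λ a → 0ℤ + + 2 * G * a) Z₀) (solve vars))

  Z₂≡ : Z 2 ≡ (+ 3 * G - + 4) * G + + 2 * U - + 2
  Z₂≡ = trans (substitute (+ 2 * U - N - + 1 - G * G - + 2 * (+ 2 * G)) (Z-step 0) Z₀ Z₁≡) (solve vars)

  Z₃≡ : Z 3 ≡ ((+ 6 * G - + 4) * G + + 4 * N - + 4) * G
  Z₃≡ = trans (substitute (+ 2 * G * (+ 2 * G) - + 2 * G * (+ 2 * U - N - + 1)) (Z-step 1) Z₁≡ Z₂≡) (solve vars)

  Z₄≡ : Z 4 ≡ (((+ 12 * G - + 8) * G + + 2 * U + + 10 * N - + 12) * G - + 4 * N + + 4) * G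
              + + 2 * U * N - + 2 * U - + 4 * N + + 4
  Z₄≡ = trans (substitute (G * G * (+ 2 * U - N - + 1) - + 2 * (N - + 1)) (Z-step 2) Z₂≡ Z₃≡) (solve vars)

  Z₅≡ : Z 5 ≡ ((((+ 24 * G - + 16) * G + + 4 * U + + 26 * N - + 30) * G - + 12 * N + + 12) * G
              + + 4 * U * N - + 4 * U + + 4 * N * N - + 14 * N + + 10) * G
  Z₅≡ = trans (substitute (+ 2 * G * (N - + 1)) (Z-step 3) Z₃≡ Z₄≡) (solve vars)

Δ-nonneg-genus0 : ∀ U N → 0ℤ ≤ U - + 2 → 0ℤ ≤ N - + 1 → 0ₚ ≤ₚ GapUN.Δ 0ℤ U N
Δ-nonneg-genus0 U N u≥2 n≥1 = ⊗-nonneg {Z} {B⁻¹} Z≥0 (B⁻¹-nonneg (# 2 ⊛ # 0) n≥1)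
  where
  open GapUN 0ℤ U N
  vars = U ∷ N ∷ []
  Z≥0 : 0ₚ ≤ₚ Z
  Z≥0 = nonneg-from-4 {Z} (0≤-by (# 1) Z₀) (0≤-by (# 2 ⊛ # 0) Z₁≡)
    (0≤-by (# 2 ⊛ (u≥2 ⊕ # 1)) (trans Z₂≡ (solve vars))) (0≤-by (# 0) (trans Z₃≡ (solve vars)))
    (nonneg-recurrence (λ k → Z (4 ℕ.+ k)) (# 2 ⊛ # 0) n≥1 Z-tail
      (0≤-by (# 2 ⊛ u≥2 ⊛ n≥1) (trans Z₄≡ (solve vars))) (0≤-by (# 0) (trans Z₅≡ (solve vars))))

Δ-nonneg-genus1 : ∀ U N → 0ℤ ≤ U - + 1 → 0ℤ ≤ N - + 1 → 0ₚ ≤ₚ GapUN.Δ (+ 1) U N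
-- Z 2 may be -1 here; it is Z′ = Z - (1 - t²) that is nonnegative.
Δ-nonneg-genus1 U N u≥1 n≥1 k =
  0≤-by (# 1 ⊛ ⊗-nonneg {Z′} {B⁻¹} Z′≥0 B⁻¹≥0 k ⊕ # 1 ⊛ lag₂-difference-nonneg B⁻¹≥0 B⁻¹-increasing k)
        (trans (⊗-congʳ B⁻¹ (λ i → recombine (Z i) (poly E i)) k) (⊗-distribʳ (+ 1) (+ 1) Z′ (poly E) B⁻¹ k))
  where
  open GapUN (+ 1) U N
  vars = U ∷ N ∷ []
  E : List ℤ
  E = + 1 ∷ 0ℤ ∷ - + 1 ∷ []
  Z′ : PowerSeries
  Z′ i = Z i - poly E i
  recombine : ∀ a b → a ≡ + 1 * (a - b) + + 1 * b
  recombine = solve-∀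
  B⁻¹≥0 : 0ₚ ≤ₚ B⁻¹
  B⁻¹≥0 = proj₁ (B⁻¹-monotone (# 0) (n≥1 ⊕ # 1))
  B⁻¹-increasing : ∀ k → 0ℤ ≤ B⁻¹ (2 ℕ.+ k) - B⁻¹ k
  B⁻¹-increasing = proj₂ (B⁻¹-monotone (# 0) (n≥1 ⊕ # 1))
  Z′≥0 : 0ₚ ≤ₚ Z′
  Z′≥0 = nonneg-from-4 {Z′} (0≤-by (# 0) (cong (λ a → a - + 1) Z₀)) (0≤-by (# 2) (cong (λ a → a - 0ℤ) Z₁≡))
    (0≤-by (# 2 ⊛ u≥1) (trans (cong (λ a → a - - + 1) Z₂≡) (solve vars)))
    (0≤-by (# 2 ⊛ (# 2 ⊛ n≥1 ⊕ # 1)) (trans (cong (λ a → a - 0ℤ) Z₃≡) (solve vars)))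
    (λ k → 0≤-by (tail≥0 k) (ℤ.+-identityʳ (Z (4 ℕ.+ k))))
    where
    tail≥0 = nonneg-recurrence (λ k → Z (4 ℕ.+ k)) (# 2 ⊛ # 1) n≥1 Z-tail
      (0≤-by (# 2 ⊛ (n≥1 ⊕ # 1) ⊛ (u≥1 ⊕ # 2)) (trans Z₄≡ (solve vars)))
      (0≤-by (# 4 ⊛ (n≥1 ⊕ # 1) ⊛ (u≥1 ⊕ # 1 ⊕ n≥1 ⊕ # 1)) (trans Z₅≡ (solve vars)))

Δ-nonneg-genus≥2 : ∀ H U N → 0ℤ ≤ H → 0ℤ ≤ U → 0ℤ ≤ N → 0ₚ ≤ₚ GapUN.Δ (+ 2 + H) U N
-- Here n may be 0, i.e. S = -1, so Z and B⁻¹ are controlled by the monotone recurrence.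
Δ-nonneg-genus≥2 H U N h u n = ⊗-nonneg {Z} {B⁻¹} Z≥0 (proj₁ (B⁻¹-monotone G₂≥2 S≥-1))
  where
  open GapUN (+ 2 + H) U N
  vars = H ∷ U ∷ N ∷ []
  G₂≥2 : 0ℤ ≤ + 2 * (+ 2 + H) - + 2
  G₂≥2 = 0≤-by (# 2 ⊕ # 2 ⊛ h) (solve (H ∷ []))
  S≥-1 : 0ℤ ≤ N - + 1 + + 1
  S≥-1 = 0≤-by n (solve (N ∷ []))
  Z₄≥0 : 0ℤ ≤ Z 4
  Z₄≥0 = 0≤-by (h ⊛ (h ⊛ (h ⊛ (# 12 ⊛ h ⊕ # 88) ⊕ # 2 ⊛ u ⊕ # 10 ⊛ n ⊕ # 228) ⊕ # 8 ⊛ u ⊕ # 36 ⊛ n ⊕ # 244)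
                ⊕ # 2 ⊛ u ⊛ n ⊕ # 6 ⊛ u ⊕ # 28 ⊛ n ⊕ # 92)
               (trans Z₄≡ (solve vars))
  Z₄≤Z₅ : 0ℤ ≤ Z 5 - Z 4
  Z₄≤Z₅ = 0≤-by (h ⊛ (h ⊛ (h ⊛ (h ⊛ (# 24 ⊛ h ⊕ # 212) ⊕ # 4 ⊛ u ⊕ # 26 ⊛ n ⊕ # 714)
                            ⊕ # 22 ⊛ u ⊕ # 134 ⊛ n ⊕ # 1140)
                       ⊕ # 4 ⊛ u ⊛ n ⊕ # 36 ⊛ u ⊕ # 4 ⊛ n ⊛ n ⊕ # 214 ⊛ n ⊕ # 862)
                 ⊕ # 6 ⊛ u ⊛ n ⊕ # 18 ⊛ u ⊕ # 8 ⊛ n ⊛ n ⊕ # 104 ⊛ n ⊕ # 248)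
                (trans (cong₂ _-_ Z₅≡ Z₄≡) (solve vars))
  Z≥0 : 0ₚ ≤ₚ Z
  Z≥0 = nonneg-from-4 {Z} (0≤-by (# 1) Z₀) (0≤-by (# 2 ⊛ (# 2 ⊕ h)) Z₁≡)
    (0≤-by (# 3 ⊛ h ⊛ h ⊕ # 8 ⊛ h ⊕ # 2 ⊛ u ⊕ # 2) (trans Z₂≡ (solve vars)))
    (0≤-by (h ⊛ (h ⊛ (# 6 ⊛ h ⊕ # 32) ⊕ # 4 ⊛ n ⊕ # 52) ⊕ # 8 ⊛ n ⊕ # 24) (trans Z₃≡ (solve vars)))
    (λ k → proj₁ (monotone-recurrence {+ 2 * (+ 2 + H)} {N - + 1} (λ k → Z (4 ℕ.+ k))
                                       G₂≥2 S≥-1 Z-tail Z₄≥0 Z₄≤Z₅ k))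

half-bound : ∀ k n₁ m → 2 ℕ.* k ℕ.< n₁ ℕ.+ 2 ℕ.* m → k ℕ.< n₁ ℕ.+ m
half-bound k n₁ m 2k<n = ℕ.*-cancelˡ-< 2 k (n₁ ℕ.+ m) (ℕ.<-≤-trans 2k<n n≤2u)
  where
  n≤2u : n₁ ℕ.+ 2 ℕ.* m ℕ.≤ 2 ℕ.* (n₁ ℕ.+ m)
  n≤2u = subst (n₁ ℕ.+ 2 ℕ.* m ℕ.≤_) (sym (ℕ.*-distribˡ-+ 2 n₁ m)) (ℕ.+-mono-≤ (ℕ.m≤n*m n₁ 2) ℕ.≤-refl)

Δ-nonneg : ∀ g n₁ m → 2 ℕ.< 2 ℕ.* g ℕ.+ (n₁ ℕ.+ 2 ℕ.* m) →
  0ₚ ≤ₚ GapUN.Δ (+ g) (+ (n₁ ℕ.+ m)) (+ (n₁ ℕ.+ 2 ℕ.* m))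
Δ-nonneg zero n₁ m 2<n = Δ-nonneg-genus0 (+ (n₁ ℕ.+ m)) (+ (n₁ ℕ.+ 2 ℕ.* m))
  (ℤ.i≤j⇒0≤j-i (+≤+ (half-bound 1 n₁ m 2<n))) (ℤ.i≤j⇒0≤j-i (+≤+ (ℕ.≤-trans (s≤s z≤n) 2<n)))
Δ-nonneg (suc zero) n₁ m (s≤s (s≤s 0<n)) = Δ-nonneg-genus1 (+ (n₁ ℕ.+ m)) (+ (n₁ ℕ.+ 2 ℕ.* m))
  (ℤ.i≤j⇒0≤j-i (+≤+ (half-bound 0 n₁ m 0<n))) (ℤ.i≤j⇒0≤j-i (+≤+ 0<n))
Δ-nonneg (suc (suc h)) n₁ m _ = Δ-nonneg-genus≥2 (+ h) (+ (n₁ ℕ.+ m)) (+ (n₁ ℕ.+ 2 ℕ.* m)) (# h) (# _) (# _)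

n₁-via-u-n : ∀ n₁ m → + n₁ - + 1 ≡ + 2 * + (n₁ ℕ.+ m) - + (n₁ ℕ.+ 2 ℕ.* m) - + 1
n₁-via-u-n n₁ m =
  trans (identity (+ n₁) (+ m)) (cong (λ x → + 2 * (+ n₁ + + m) - (+ n₁ + x) - + 1) (sym (ℤ.pos-* 2 m)))
  where
  identity : ∀ c d → c - + 1 ≡ + 2 * (c + d) - (c + + 2 * d) - + 1
  identity = solve-∀

lemma3p2 : (g n n₁ : ℕ) → n₁ ℕ.≤ n → (∃ λ m → n ≡ n₁ ℕ.+ 2 ℕ.* m) → 2 ℕ.< 2 ℕ.* g ℕ.+ n →
    lhs g n n₁ ≤ₚ rhs g n
-- The hypothesis n₁ ≤ n is implied by n = n₁ + 2m.
lemma3p2 g .(n₁ ℕ.+ 2 ℕ.* m) n₁ _ (m , refl) 2<2g+n k =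
  ℤ.0≤i-j⇒j≤i (0≤-by (Δ-nonneg g n₁ m 2<2g+n k) (trans (Gap.rhs-lhs≡Δ G G₂ S R k) (reparametrise k)))
  where
  G = + g
  G₂ = + (2 ℕ.* g)
  S = + (n₁ ℕ.+ 2 ℕ.* m) - + 1
  R = + n₁ - + 1
  reparametrise : ∀ k → Gap.Δ G G₂ S R k ≡ GapUN.Δ G (+ (n₁ ℕ.+ m)) (+ (n₁ ℕ.+ 2 ℕ.* m)) k
  reparametrise k = cong₂ (λ G₂ R → Gap.Δ G G₂ S R k) (ℤ.pos-* 2 g) (n₁-via-u-n n₁ m)
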